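{- $F_\infty(M(4)) = 9$, where $M(4)$ is the graph on $4$ vertices consisting of $2$ disjoint edges.
   Context: For a finite graph $G$ with $n$ vertices and an integer $b\ge 0$, a permutation of the vertices of $G$ with $b$ blank spaces is a sequence of length $n+b$ in which every vertex of $G$ appears exactly once and the remaining $b$ entries are a blank symbol $*$. Two such sequences $\pi,\sigma$ are $G$-different if there is a position $i$ such that $\pi(i),\sigma(i)$ are both vertices and $\{\pi(i),\sigma(i)\}$ is an edge of $G$. $F_b(G)$ is the maximum size of a family of pairwise $G$-different permutations of the vertices of $G$ with $b$ blank spaces, and $F_\infty(G)=\sup_{b\ge0}F_b(G)$. -}

module Defs where

open import Data.Nat using (ℕ; _+_; _≤_)
open import Data.Fin using (Fin; zero; suc)
open import Data.Maybe using (Maybe; just; nothing)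
open import Data.Product using (Σ; _×_; ∃; ∃-syntax)
open import Relation.Binary.PropositionalEquality using (_≡_; _≢_)
open import Relation.Nullary using (¬_)

record Graph (n : ℕ) : Set₁ where
  field
    Edge   : Fin n → Fin n → Set
    sym    : ∀ {u v} → Edge u v → Edge v u
    irrefl : ∀ {u} → ¬ Edge u u
open Graph public

-- A sequence of length n + b over vertices and the blank symbol * (= nothing).
Seq : ℕ → ℕ → Set
Seq n b = Fin (n + b) → Maybe (Fin n)

-- A permutation of the vertices with b blank spaces: every vertex occurs
-- exactly once (all remaining b entries are then blanks).
IsBlankPerm : ∀ {n b} → Seq n b → Set
IsBlankPerm {n} {b} π =
  ∀ (v : Fin n) → Σ (Fin (n + b)) λ i → (π i ≡ just v) × (∀ j → π j ≡ just v → j ≡ i)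

GDifferent : ∀ {n b} → Graph n → Seq n b → Seq n b → Set
GDifferent {n} {b} G π σ =
  ∃[ i ] ∃[ u ] ∃[ v ] (π i ≡ just u × σ i ≡ just v × Edge G u v)

Family : ∀ {n} → Graph n → (b m : ℕ) → Set
Family {n} G b m =
  Σ (Fin m → Seq n b) λ f →
    (∀ k → IsBlankPerm (f k)) × (∀ k l → k ≢ l → GDifferent G (f k) (f l))

-- F_∞(G) = c : c = sup_b F_b(G), i.e. some b admits a family of size c,
-- and no b admits a family of size larger than c.
F∞≡ : ∀ {n} → Graph n → ℕ → Set
F∞≡ G c = (∃[ b ] Family G b c) × (∀ b m → Family G b m → m ≤ c)

data M4Edge : Fin 4 → Fin 4 → Set where
  e01 : M4Edge zero (suc zero)
  e10 : M4Edge (suc zero) zero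
  e23 : M4Edge (suc (suc zero)) (suc (suc (suc zero)))
  e32 : M4Edge (suc (suc (suc zero))) (suc (suc zero))

M4 : Graph 4
M4 = record
  { Edge = M4Edge
  ; sym = λ { e01 → e10 ; e10 → e01 ; e23 → e32 ; e32 → e23 }
  ; irrefl = λ () }

module Submission where

-- Lower bound: the three cyclic shifts of (0 1 *) are pairwise {0,1}-different, and likewise for
-- (2 3 *); concatenating any shift of the first kind with any shift of the second gives nine
-- pairwise M(4)-different permutations with two blanks.
--
-- Upper bound: in a permutation with blanks, record the positions of vertices 0,1 as a red arc
-- and those of 2,3 as a blue arc. If two permutations are M(4)-different, then their red arcs or
-- their blue arcs are linked (one arc ends where the other starts). The bound then follows from
-- three facts about such configurations of arc pairs:
--   * no four proper arcs are pairwise linked, so at most three members can be pairwise apart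
--     (red arcs unlinked, hence blue arcs linked);
--   * if three members share their red tail p, then the members split into those with red head p,
--     those with red tail p, and those away from p, each class of size at most three;
--   * around any member k, every other member lies in one of four classes (red or blue arc leaving
--     or entering the corresponding end of k's arc); either each class has at most two members,
--     giving 1 + 4·2 = 9, or one class contains three members sharing an end, and the previous
--     fact applies after reorienting the configuration.

open import Defs hiding (sym)
open import Level using (0ℓ)
open import Data.Nat using (ℕ; suc; _+_; _∸_; _≤_; z≤n; s≤s)
open import Data.Nat.Properties using (+-suc; +-mono-≤; ∸-monoˡ-≤; m+n∸n≡m; ≤-refl; module ≤-Reasoning)
open import Data.Fin using (Fin; zero; suc; remQuot)
open import Data.Fin.Properties using (_≟_; any?; all?)
open import Data.Maybe using (Maybe; just; nothing)
open import Data.Maybe.Properties using (just-injective; ≡-dec)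
open import Data.Vec using (Vec; []; _∷_; lookup; _++_)
open import Data.List using (List; []; _∷_; length; filter; map; allFin) renaming (_++_ to _++ˡ_)
open import Data.List.Properties using (length-map; length-++; length-tabulate)
open import Data.List.Relation.Unary.All as All using (All; []; _∷_)
open import Data.List.Relation.Unary.All.Properties using (all-filter) renaming (filter⁺ to All-filter⁺; map⁺ to All-map⁺)
open import Data.List.Relation.Unary.AllPairs as AllPairs using (AllPairs; []; _∷_)
import Data.List.Relation.Unary.AllPairs.Properties as AllPairsₚ
open import Data.List.Relation.Unary.Unique.Propositional using (Unique)
open import Data.List.Relation.Unary.Unique.Propositional.Properties using (allFin⁺) renaming (filter⁺ to Unique-filter⁺)
open import Data.Product using (_×_; _,_; proj₁; proj₂; swap)
open import Data.Sum using (_⊎_; inj₁; inj₂; [_,_]′)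
import Data.Sum as Sum
open import Data.Empty using (⊥; ⊥-elim)
open import Data.Unit using (tt)
open import Function using (_∘_; id)
open import Relation.Nullary using (¬_; yes; no; Dec)
open import Relation.Nullary.Decidable using (toWitness; ¬?; _×-dec_; _→-dec_)
open import Relation.Unary using (Pred; Decidable; U; _∩_; _∪_; ∁; _⊆_)
open import Relation.Unary.Properties using (∁?)
open import Relation.Binary.Definitions using (DecidableEquality)
open import Relation.Binary.PropositionalEquality using (_≡_; _≢_; refl; sym; trans; cong; subst)

module Counting {A : Set} where

  private variable
    Q R S : Pred A 0ℓ
    n n₁ n₂ : ℕ

  AtMost : ℕ → Pred A 0ℓ → Set
  AtMost n Q = ∀ {xs} → Unique xs → All Q xs → length xs ≤ n

  atMost-mono : Q ⊆ R → AtMost n R → AtMost n Q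
  atMost-mono Q⊆R bound u qs = bound u (All.map Q⊆R qs)

  atMost-none : (∀ {z} → ¬ Q z) → AtMost 0 Q
  atMost-none empty _ []      = z≤n
  atMost-none empty _ (q ∷ _) = ⊥-elim (empty q)

  atMost-zero : AtMost 0 Q → ∀ {z} → ¬ Q z
  atMost-zero bound qz with bound ([] ∷ []) (qz ∷ [])
  ... | ()

  length-filter-split : (R? : Decidable R) (xs : List A) →
                        length xs ≡ length (filter R? xs) + length (filter (∁? R?) xs)
  length-filter-split R? []       = refl
  length-filter-split R? (x ∷ xs) with R? x
  ... | yes _ = cong suc (length-filter-split R? xs)
  ... | no  _ = trans (cong suc (length-filter-split R? xs)) (sym (+-suc _ _))

  split-≤ : (R? : Decidable R) (xs : List A) → length (filter R? xs) ≤ n₁ →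
            length (filter (∁? R?) xs) ≤ n₂ → length xs ≤ n₁ + n₂
  split-≤ R? xs in-R out-R = begin
    length xs                                          ≡⟨ length-filter-split R? xs ⟩
    length (filter R? xs) + length (filter (∁? R?) xs) ≤⟨ +-mono-≤ in-R out-R ⟩
    _                                                  ∎
    where open ≤-Reasoning

  atMost-split : (R? : Decidable R) →
                 AtMost n₁ (Q ∩ R) → AtMost n₂ (Q ∩ ∁ R) → AtMost (n₁ + n₂) Q
  atMost-split R? in-R out-R {xs} u qs = split-≤ R? xs
    (in-R  (Unique-filter⁺ R? u)       (All.zip (All-filter⁺ R? qs , all-filter R? xs)))
    (out-R (Unique-filter⁺ (∁? R?) u) (All.zip (All-filter⁺ (∁? R?) qs , all-filter (∁? R?) xs)))

  split-or : {E : Set} (R? : Decidable R) (xs : List A) →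
             length (filter R? xs) ≤ n₁ ⊎ E → length (filter (∁? R?) xs) ≤ n₂ ⊎ E →
             length xs ≤ n₁ + n₂ ⊎ E
  split-or R? xs (inj₁ in-R) (inj₁ out-R) = inj₁ (split-≤ R? xs in-R out-R)
  split-or R? xs (inj₂ e)    _            = inj₂ e
  split-or R? xs (inj₁ _)    (inj₂ e)     = inj₂ e

  filter-residue : (R? : Decidable R) {xs : List A} → All (R ∪ S) xs → All S (filter (∁? R?) xs)
  filter-residue {R = R} {S = S} R? {xs} rs =
    All.map residue (All.zip (All-filter⁺ (∁? R?) rs , all-filter (∁? R?) xs))
    where
    residue : (R ∪ S) ∩ ∁ R ⊆ S
    residue (inj₁ r , ¬r) = ⊥-elim (¬r r)
    residue (inj₂ s , _)  = s

  allPairs-intro : {Rel : A → A → Set} → (∀ {x y} → Q x → Q y → x ≢ y → Rel x y) →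
                   ∀ {xs} → Unique xs → All Q xs → AllPairs Rel xs
  allPairs-intro r []          []        = []
  allPairs-intro r (a∉ ∷ u) (qa ∷ qs) =
    All.zipWith (λ (a≢b , qb) → r qa qb a≢b) (a∉ , qs) ∷ allPairs-intro r u qs

  record Triple (Q : Pred A 0ℓ) : Set where
    field
      a b c       : A
      a≢b         : a ≢ b
      a≢c         : a ≢ c
      b≢c         : b ≢ c
      qa          : Q a
      qb          : Q b
      qc          : Q c

  rotate exchange : Triple Q → Triple Q
  rotate   T = record { a = b ; b = c ; c = a ; a≢b = b≢c ; a≢c = a≢b ∘ sym ; b≢c = a≢c ∘ sym
                      ; qa = qb ; qb = qc ; qc = qa }
    where open Triple T
  exchange T = record { a = a ; b = c ; c = b ; a≢b = a≢c ; a≢c = a≢b ; b≢c = b≢c ∘ sym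
                      ; qa = qa ; qb = qc ; qc = qb }
    where open Triple T

  short-or-triple : ∀ {xs} → Unique xs → All Q xs → length xs ≤ 2 ⊎ Triple Q
  short-or-triple {xs = []}            _ _ = inj₁ z≤n
  short-or-triple {xs = _ ∷ []}        _ _ = inj₁ (s≤s z≤n)
  short-or-triple {xs = _ ∷ _ ∷ []}    _ _ = inj₁ ≤-refl
  short-or-triple {xs = a ∷ b ∷ c ∷ _} ((a≢b ∷ a≢c ∷ _) ∷ (b≢c ∷ _) ∷ _) (qa ∷ qb ∷ qc ∷ _) =
    inj₂ (record { a = a ; b = b ; c = c ; a≢b = a≢b ; a≢c = a≢c ; b≢c = b≢c
                 ; qa = qa ; qb = qb ; qc = qc })

Arc : Set → Set
Arc P = P × P

module _ {P : Set} where

  tail head : Arc P → P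
  tail = proj₁
  head = proj₂

  Proper : Arc P → Set
  Proper e = tail e ≢ head e

  Linked : Arc P → Arc P → Set
  Linked e f = head e ≡ tail f ⊎ head f ≡ tail e

  same-tail-unlinked : ∀ {e f} → Proper e → Proper f → tail e ≡ tail f → ¬ Linked e f
  same-tail-unlinked pe pf ee (inj₁ ef) = pe (trans ee (sym ef))
  same-tail-unlinked pe pf ee (inj₂ fe) = pf (trans (sym ee) (sym fe))

  same-head-unlinked : ∀ {e f} → Proper e → Proper f → head e ≡ head f → ¬ Linked e f
  same-head-unlinked pe pf ee (inj₁ ef) = pf (trans (sym ef) ee)
  same-head-unlinked pe pf ee (inj₂ fe) = pe (trans (sym fe) (sym ee))

  -- Among three arcs linked to e, two are linked to it on the same side, hence share their tail
  -- or their head; so no four proper arcs are pairwise linked.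
  no-linked-four : ∀ {e f g h} → Proper f → Proper g → Proper h →
                   Linked e f → Linked e g → Linked e h → Linked f g → Linked f h → Linked g h → ⊥
  no-linked-four pf pg ph (inj₁ ef) (inj₁ eg) _ fg _ _ = same-tail-unlinked pf pg (trans (sym ef) eg) fg
  no-linked-four pf pg ph (inj₂ fe) (inj₂ ge) _ fg _ _ = same-head-unlinked pf pg (trans fe (sym ge)) fg
  no-linked-four pf pg ph (inj₁ ef) (inj₂ ge) (inj₁ eh) _ fh _ = same-tail-unlinked pf ph (trans (sym ef) eh) fh
  no-linked-four pf pg ph (inj₁ ef) (inj₂ ge) (inj₂ he) _ _ gh = same-head-unlinked pg ph (trans ge (sym he)) gh
  no-linked-four pf pg ph (inj₂ fe) (inj₁ eg) (inj₁ eh) _ _ gh = same-tail-unlinked pg ph (trans (sym eg) eh) gh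
  no-linked-four pf pg ph (inj₂ fe) (inj₁ eg) (inj₂ he) _ fh _ = same-head-unlinked pf ph (trans fe (sym he)) fh

  linked-bound : ∀ {es} → All Proper es → AllPairs Linked es → length es ≤ 3
  linked-bound {[]}              _ _ = z≤n
  linked-bound {_ ∷ []}          _ _ = s≤s z≤n
  linked-bound {_ ∷ _ ∷ []}      _ _ = s≤s (s≤s z≤n)
  linked-bound {_ ∷ _ ∷ _ ∷ []}  _ _ = ≤-refl
  linked-bound {_ ∷ _ ∷ _ ∷ _ ∷ _} (_ ∷ pf ∷ pg ∷ ph ∷ _)
               ((ef ∷ eg ∷ eh ∷ _) ∷ (fg ∷ fh ∷ _) ∷ (gh ∷ _) ∷ _) =
    ⊥-elim (no-linked-four pf pg ph ef eg eh fg fh gh)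

  proper-swap : ∀ {e} → Proper e → Proper (swap e)
  proper-swap pe = pe ∘ sym

  linked-swap : ∀ {e f} → Linked e f → Linked (swap e) (swap f)
  linked-swap (inj₁ ef) = inj₂ (sym ef)
  linked-swap (inj₂ fe) = inj₁ (sym fe)

record Config (M P : Set) : Set where
  field
    red blue    : M → Arc P
    red-proper  : ∀ k → Proper (red k)
    blue-proper : ∀ k → Proper (blue k)
    linked      : ∀ {k l} → k ≢ l → Linked (red k) (red l) ⊎ Linked (blue k) (blue l)

reverse-red : ∀ {M P} → Config M P → Config M P
reverse-red C = record
  { red = swap ∘ red ; blue = blue
  ; red-proper = proper-swap ∘ red-proper ; blue-proper = blue-proper
  ; linked = Sum.map₁ linked-swap ∘ linked }
  where open Config C

swap-colours : ∀ {M P} → Config M P → Config M P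
swap-colours C = record
  { red = blue ; blue = red
  ; red-proper = blue-proper ; blue-proper = red-proper
  ; linked = Sum.swap ∘ linked }
  where open Config C

-- Bounds on classes of members of a configuration, phrased in terms of red arcs; the other
-- orientations are reached through reverse-red and swap-colours.
module Members {M P : Set} (C : Config M P) (_≟ₚ_ : DecidableEquality P) where
  open Config C
  open Counting {M}

  src tgt : M → P
  src k = tail (red k)
  tgt k = head (red k)

  -- Distinct members are apart when their red arcs are not linked; their blue arcs are then linked.
  Unlinked Apart : M → M → Set
  Unlinked k l = ¬ Linked (red k) (red l)
  Apart k l    = k ≢ l × Unlinked k l

  apart : ∀ {k l} → k ≢ l → tgt k ≢ src l → tgt l ≢ src k → Apart k l
  apart k≢l kl lk = k≢l , [ kl , lk ]′

  same-src-unlinked : ∀ {k l} → src k ≡ src l → Unlinked k l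
  same-src-unlinked = same-tail-unlinked (red-proper _) (red-proper _)

  same-tgt-unlinked : ∀ {k l} → tgt k ≡ tgt l → Unlinked k l
  same-tgt-unlinked = same-head-unlinked (red-proper _) (red-proper _)

  -- At most three members are pairwise apart, since their blue arcs are pairwise linked.
  apart-bound : ∀ {ks} → AllPairs Apart ks → length ks ≤ 3
  apart-bound {ks} ks-apart = begin
    length ks            ≡⟨ sym (length-map blue ks) ⟩
    length (map blue ks) ≤⟨ linked-bound (All-map⁺ (All.universal blue-proper ks))
                                         (AllPairsₚ.map⁺ (AllPairs.map blue-linked ks-apart)) ⟩
    3                    ∎
    where
    open ≤-Reasoning
    blue-linked : ∀ {k l} → Apart k l → Linked (blue k) (blue l)
    blue-linked (k≢l , unlinked) = [ ⊥-elim ∘ unlinked , id ]′ (linked k≢l)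

  apart-extend : ∀ {Q} os → AllPairs Apart os → (∀ {k} → Q k → All (Apart k) os) →
                 (∀ {k l} → Q k → Q l → k ≢ l → Unlinked k l) → AtMost (3 ∸ length os) Q
  apart-extend os os-apart Q-os Q-unlinked {xs} u qs = begin
    length xs                           ≡⟨ sym (m+n∸n≡m (length xs) (length os)) ⟩
    length xs + length os ∸ length os   ≡⟨ cong (_∸ length os) (sym (length-++ xs)) ⟩
    length (xs ++ˡ os) ∸ length os      ≤⟨ ∸-monoˡ-≤ (length os) (apart-bound all-apart) ⟩
    3 ∸ length os                       ∎
    where
    open ≤-Reasoning
    all-apart : AllPairs Apart (xs ++ˡ os)
    all-apart = AllPairsₚ.++⁺ (allPairs-intro (λ qk ql k≢l → k≢l , Q-unlinked qk ql k≢l) u qs)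
                             os-apart (All.map Q-os qs)

  same-src-bound : ∀ p → AtMost 3 (λ k → src k ≡ p)
  same-src-bound p = apart-extend [] [] (λ _ → []) (λ sk sl _ → same-src-unlinked (trans sk (sym sl)))

  same-tgt-bound : ∀ p → AtMost 3 (λ k → tgt k ≡ p)
  same-tgt-bound p = apart-extend [] [] (λ _ → []) (λ tk tl _ → same-tgt-unlinked (trans tk (sym tl)))

  module AroundPosition (p : P) where

    Away : M → Set
    Away k = src k ≢ p × tgt k ≢ p

    -- Away members with red tail q and members with red tail p but red head other than q are
    -- pairwise apart, so the former number at most 3 ∸ (number of the latter).
    away-class-bound : ∀ q os → Unique os → All (λ k → src k ≡ p × tgt k ≢ q) os →
                       AtMost (3 ∸ length os) (λ k → Away k × src k ≡ q)
    away-class-bound q os u os-p =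
      apart-extend os (allPairs-intro from-p-apart u os-p) (λ qk → All.map (away-apart qk) os-p)
                   (λ (_ , sk) (_ , sl) _ → same-src-unlinked (trans sk (sym sl)))
      where
      from-p-apart : ∀ {k l} → src k ≡ p × tgt k ≢ q → src l ≡ p × tgt l ≢ q → k ≢ l → Apart k l
      from-p-apart (sk , _) (sl , _) k≢l = k≢l , same-src-unlinked (trans sk (sym sl))
      away-apart : ∀ {k l} → Away k × src k ≡ q → src l ≡ p × tgt l ≢ q → Apart k l
      away-apart ((sk≢p , tk≢p) , sk) (sl , tl≢q) =
        apart (λ k≡l → sk≢p (trans (cong src k≡l) sl)) (λ e → tk≢p (trans e sl)) (λ e → tl≢q (trans e sk))

    Star : Set
    Star = Triple (λ k → src k ≡ p)

    -- An away member is apart from every member of a star whose red head is not its red tail;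
    -- so its red tail is the red head of some member of the star.
    off-heads-empty : (T : Star) → let open Triple T in
                      ∀ {k} → Away k → src k ≢ tgt a → src k ≢ tgt b → src k ≢ tgt c → ⊥
    off-heads-empty T {k} away ka kb kc =
      atMost-zero (away-class-bound (src k) (a ∷ b ∷ c ∷ []) ((a≢b ∷ a≢c ∷ []) ∷ (b≢c ∷ []) ∷ [] ∷ [])
                                    ((qa , ka ∘ sym) ∷ (qb , kb ∘ sym) ∷ (qc , kc ∘ sym) ∷ []))
                  (away , refl)
      where open Triple T

    -- Hence at most three members are away from p, whatever the coincidences among the red heads
    -- of a star, since an away member with red tail q is apart from the star members not ending
    -- at q. If all heads coincide, the away members share their red tail.
    away-bound-equal : (T : Star) → let open Triple T in tgt a ≡ tgt b → tgt a ≡ tgt c → AtMost 3 Away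
    away-bound-equal T ab ac =
      atMost-split (λ k → src k ≟ₚ tgt a) (away-class-bound (tgt a) [] [] [])
      (atMost-none (λ (away , ka) →
        off-heads-empty T away ka (λ e → ka (trans e (sym ab))) (λ e → ka (trans e (sym ac)))))
      where open Triple T

    -- If tgt a = tgt b ≠ tgt c: at most two away members start at tgt a (they are apart from c),
    -- at most one starts at tgt c (it is apart from a and b).
    away-bound-pair : (T : Star) → let open Triple T in tgt a ≡ tgt b → tgt a ≢ tgt c → AtMost 3 Away
    away-bound-pair T ab ac =
      atMost-split (λ k → src k ≟ₚ tgt a)
        (away-class-bound (tgt a) (c ∷ []) ([] ∷ []) ((qc , ac ∘ sym) ∷ []))
      (atMost-split (λ k → src k ≟ₚ tgt c)
        (atMost-mono (λ ((away , _) , e) → away , e)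
          (away-class-bound (tgt c) (a ∷ b ∷ []) ((a≢b ∷ []) ∷ [] ∷ [])
                            ((qa , ac) ∷ (qb , λ e → ac (trans ab e)) ∷ [])))
      (atMost-none (λ ((away , ka) , kc) → off-heads-empty T away ka (λ e → ka (trans e (sym ab))) kc)))
      where open Triple T

    -- If the three heads are distinct, at most one away member starts at each of them.
    away-bound-distinct : (T : Star) → let open Triple T in
                          tgt a ≢ tgt b → tgt a ≢ tgt c → tgt b ≢ tgt c → AtMost 3 Away
    away-bound-distinct T ab ac bc =
      atMost-split (λ k → src k ≟ₚ tgt a)
        (away-class-bound (tgt a) (b ∷ c ∷ []) ((b≢c ∷ []) ∷ [] ∷ []) ((qb , ab ∘ sym) ∷ (qc , ac ∘ sym) ∷ []))
      (atMost-split (λ k → src k ≟ₚ tgt b)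
        (atMost-mono (λ ((away , _) , e) → away , e)
          (away-class-bound (tgt b) (a ∷ c ∷ []) ((a≢c ∷ []) ∷ [] ∷ []) ((qa , ab) ∷ (qc , bc ∘ sym) ∷ [])))
      (atMost-split (λ k → src k ≟ₚ tgt c)
        (atMost-mono (λ (((away , _) , _) , e) → away , e)
          (away-class-bound (tgt c) (a ∷ b ∷ []) ((a≢b ∷ []) ∷ [] ∷ []) ((qa , ac) ∷ (qb , bc) ∷ [])))
      (atMost-none (λ (((away , ka) , kb) , kc) → off-heads-empty T away ka kb kc))))
      where open Triple T

    away-bound : Star → AtMost 3 Away
    away-bound T with tgt a ≟ₚ tgt b | tgt a ≟ₚ tgt c | tgt b ≟ₚ tgt c
      where open Triple T
    ... | yes ab | yes ac | _      = away-bound-equal T ab ac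
    ... | yes ab | no ac  | _      = away-bound-pair T ab ac
    ... | no ab  | yes ac | _      = away-bound-pair (exchange T) ac ab
    ... | no ab  | no ac  | yes bc = away-bound-pair (rotate T) bc (ab ∘ sym)
    ... | no ab  | no ac  | no bc  = away-bound-distinct T ab ac bc

    star-bound : Star → AtMost 9 U
    star-bound T =
      atMost-split (λ k → tgt k ≟ₚ p) (atMost-mono proj₂ (same-tgt-bound p))
      (atMost-split (λ k → src k ≟ₚ p) (atMost-mono proj₂ (same-src-bound p))
      (atMost-mono (λ ((_ , tk≢p) , sk≢p) → sk≢p , tk≢p) (away-bound T)))

  src-class : ∀ q {ks} → Unique ks → All (λ k → src k ≡ q) ks → length ks ≤ 2 ⊎ AtMost 9 U
  src-class q u qs = Sum.map₂ (AroundPosition.star-bound q) (short-or-triple u qs)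

-- Around a member k, every other member has its red arc leaving the red head of k or entering
-- the red tail of k, or likewise for blue arcs. Each of these four classes consists of members
-- sharing their red tail in a reorientation of C, so it has at most two members unless a star
-- bounds the family; in the first case the family has at most 1 + 4·2 = 9 members.
module Neighbourhood {M P : Set} (C : Config M P) (_≟ₚ_ : DecidableEquality P) (k : M) where
  open Config C
  open Counting {M}

  module M₁ = Members C _≟ₚ_
  module M₂ = Members (reverse-red C) _≟ₚ_
  module M₃ = Members (swap-colours C) _≟ₚ_
  module M₄ = Members (reverse-red (swap-colours C)) _≟ₚ_

  -- The four classes: red arc leaving tgt k, red arc entering src k, and the same for blue.
  R₁ R₂ R₃ R₄ : Pred M 0ℓ
  R₁ l = M₁.src l ≡ M₁.tgt k
  R₂ l = M₂.src l ≡ M₂.tgt k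
  R₃ l = M₃.src l ≡ M₃.tgt k
  R₄ l = M₄.src l ≡ M₄.tgt k

  R₁? : Decidable R₁
  R₁? l = M₁.src l ≟ₚ M₁.tgt k
  R₂? : Decidable R₂
  R₂? l = M₂.src l ≟ₚ M₂.tgt k
  R₃? : Decidable R₃
  R₃? l = M₃.src l ≟ₚ M₃.tgt k

  classify : ∀ {l} → k ≢ l → (R₁ ∪ (R₂ ∪ (R₃ ∪ R₄))) l
  classify k≢l with linked k≢l
  ... | inj₁ (inj₁ e) = inj₁ (sym e)
  ... | inj₁ (inj₂ e) = inj₂ (inj₁ e)
  ... | inj₂ (inj₁ e) = inj₂ (inj₂ (inj₁ (sym e)))
  ... | inj₂ (inj₂ e) = inj₂ (inj₂ (inj₂ e))

  neighbours-bound : ∀ {ls} → Unique ls → All (k ≢_) ls → length ls ≤ 8 ⊎ AtMost 9 U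
  neighbours-bound {ls} u k∉ls =
    split-or R₁? ls (M₁.src-class _ (Unique-filter⁺ R₁? u) (all-filter R₁? ls))
    (split-or R₂? ls₁ (M₂.src-class _ (Unique-filter⁺ R₂? u₁) (all-filter R₂? ls₁))
    (split-or R₃? ls₂ (M₃.src-class _ (Unique-filter⁺ R₃? u₂) (all-filter R₃? ls₂))
      (M₄.src-class _ (Unique-filter⁺ (∁? R₃?) u₂) in-R₄)))
    where
    ls₁ = filter (∁? R₁?) ls
    ls₂ = filter (∁? R₂?) ls₁
    u₁ : Unique ls₁
    u₁ = Unique-filter⁺ (∁? R₁?) u
    u₂ : Unique ls₂
    u₂ = Unique-filter⁺ (∁? R₂?) u₁
    in-R₄ : All R₄ (filter (∁? R₃?) ls₂)
    in-R₄ = filter-residue R₃? (filter-residue R₂? (filter-residue R₁? (All.map classify k∉ls)))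

-- Any configuration has at most nine members: look at the neighbourhood of the first one.
family-bound : ∀ {M P} (C : Config M P) → DecidableEquality P → Counting.AtMost {M} 9 U
family-bound C _≟ₚ_ {[]}     _             _   = z≤n
family-bound C _≟ₚ_ {k ∷ ls} (k∉ls ∷ u) all-U =
  [ s≤s , (λ bound → bound (k∉ls ∷ u) all-U) ]′ (Neighbourhood.neighbours-bound C _≟ₚ_ k u k∉ls)

module BlankPerm {n b} {π : Seq n b} (perm : IsBlankPerm π) where

  position : Fin n → Fin (n + b)
  position v = proj₁ (perm v)

  at-position : ∀ {i v} → π i ≡ just v → i ≡ position v
  at-position {i} {v} = proj₂ (proj₂ (perm v)) i

  position-injective : ∀ {v w} → position v ≡ position w → v ≡ w
  position-injective {v} {w} e =
    just-injective (trans (sym (proj₁ (proj₂ (perm v)))) (trans (cong π e) (proj₁ (proj₂ (perm w)))))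

v0 v1 v2 v3 : Fin 4
v0 = zero
v1 = suc zero
v2 = suc (suc zero)
v3 = suc (suc (suc zero))

-- In a family on M(4), the positions of vertices 0,1 form the red arc of a permutation and
-- those of 2,3 its blue arc; an edge of M(4) at a common position links the corresponding arcs.
family-config : ∀ {b m} → Family M4 b m → Config (Fin m) (Fin (4 + b))
family-config {b} {m} (f , perm , different) = record
  { red         = λ k → pos k v0 , pos k v1
  ; blue        = λ k → pos k v2 , pos k v3
  ; red-proper  = λ k e → 0≢1 (BlankPerm.position-injective (perm k) e)
  ; blue-proper = λ k e → 2≢3 (BlankPerm.position-injective (perm k) e)
  ; linked      = linked }
  where
  pos : Fin m → Fin 4 → Fin (4 + b)
  pos k = BlankPerm.position (perm k)

  0≢1 : v0 ≢ v1
  0≢1 ()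
  2≢3 : v2 ≢ v3
  2≢3 ()

  shared : ∀ {k l i u v} → f k i ≡ just u → f l i ≡ just v → pos k u ≡ pos l v
  shared {k} {l} fk fl =
    trans (sym (BlankPerm.at-position (perm k) fk)) (BlankPerm.at-position (perm l) fl)

  linked : ∀ {k l} → k ≢ l → Linked (pos k v0 , pos k v1) (pos l v0 , pos l v1)
                            ⊎ Linked (pos k v2 , pos k v3) (pos l v2 , pos l v3)
  linked {k} {l} k≢l with different k l k≢l
  ... | _ , _ , _ , fk , fl , e01 = inj₁ (inj₂ (shared fl fk))
  ... | _ , _ , _ , fk , fl , e10 = inj₁ (inj₁ (shared fk fl))
  ... | _ , _ , _ , fk , fl , e23 = inj₂ (inj₂ (shared fl fk))
  ... | _ , _ , _ , fk , fl , e32 = inj₂ (inj₁ (shared fk fl))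

upper-bound : ∀ b m → Family M4 b m → m ≤ 9
upper-bound b m F = subst (_≤ 9) (length-tabulate id)
  (family-bound (family-config F) _≟_ (allFin⁺ m) (All.universal-U (allFin m)))

edge? : (u v : Fin 4) → Dec (M4Edge u v)
edge? zero                   zero                   = no λ ()
edge? zero                   (suc zero)             = yes e01
edge? zero                   (suc (suc _))          = no λ ()
edge? (suc zero)             zero                   = yes e10
edge? (suc zero)             (suc _)                = no λ ()
edge? (suc (suc _))          zero                   = no λ ()
edge? (suc (suc _))          (suc zero)             = no λ ()
edge? (suc (suc zero))       (suc (suc zero))       = no λ ()
edge? (suc (suc zero))       (suc (suc (suc zero))) = yes e23
edge? (suc (suc (suc zero))) (suc (suc zero))       = yes e32
edge? (suc (suc (suc zero))) (suc (suc (suc zero))) = no λ ()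

blank-perm? : (π : Seq 4 2) → Dec (IsBlankPerm π)
blank-perm? π = all? λ v → any? λ i → (π i ≟ₘ just v) ×-dec all? λ j → (π j ≟ₘ just v) →-dec (j ≟ i)
  where _≟ₘ_ = ≡-dec _≟_

different? : (π σ : Seq 4 2) → Dec (GDifferent M4 π σ)
different? π σ = any? λ i → any? λ u → any? λ v → (π i ≟ₘ just u) ×-dec ((σ i ≟ₘ just v) ×-dec edge? u v)
  where _≟ₘ_ = ≡-dec _≟_

-- The three cyclic shifts of (u v *); any two of them put u and v at a common position.
shifts : Fin 4 → Fin 4 → Fin 3 → Vec (Maybe (Fin 4)) 3
shifts u v zero             = just u ∷ just v  ∷ nothing ∷ []
shifts u v (suc zero)       = nothing ∷ just u ∷ just v  ∷ []
shifts u v (suc (suc zero)) = just v ∷ nothing ∷ just u  ∷ []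

product-family : Fin 9 → Seq 4 2
product-family k = lookup (shifts v0 v1 (proj₁ (remQuot {3} 3 k)) ++ shifts v2 v3 (proj₂ (remQuot {3} 3 k)))

lower-bound : Family M4 2 9
lower-bound = product-family
            , toWitness {a? = all? (λ k → blank-perm? (product-family k))} tt
            , toWitness {a? = all? λ k → all? λ l →
                               ¬? (k ≟ l) →-dec different? (product-family k) (product-family l)} tt

theorem5 : F∞≡ M4 9
theorem5 = (2 , lower-bound) , upper-bound
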